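{- Let $G=(V,E)$ be a graph, let $(A,B,D,M)$ be a nice decomposition of $G$, and let $H=H(G,A,B,D,M)$. Let $X$ be a dominant vertex cover of $G$ and let $X_{\mathrm{op}}=X_{\mathrm{op}}(A_1,A_3,M,X)$. If a vertex $v\in A$ is not reachable from $A_3$ in $H-X_{\mathrm{op}}$, then $v\in X$.
   Context: Graphs are finite and simple; $N(D)$ is the set of vertices outside $D$ with a neighbor in $D$; for a matching $M$ and covered vertex $v$, $M(v)$ is the vertex matched to $v$. A graph is factor-critical if deleting any single vertex leaves a graph with a perfect matching. A relaxed Gallai-Edmonds decomposition of $G=(V,E)$ is a tuple $(A,B,D,M)$ with $V=A\,\dot\cup\, B\,\dot\cup\, D$ and $M$ a maximum matching of $G$ such that: (1) $A=N(D)$; (2) each component of $G[D]$ is factor-critical; (3) $M$ restricted to $B$ is a perfect matching of $G[B]$; (4) $M$ restricted to any component $C$ of $G[D]$ is a near-perfect matching of $G[C]$; (5) each vertex of $A$ is matched by $M$ to a vertex of $D$. A component of $G[D]$ is matched if some $M$-edge joins it to $A$, unmatched otherwise; the decomposition is nice if there is no unmatched single-vertex component. $A_1$, $A_3$: vertices of $A$ matched by $M$ to single-vertex resp. multi-vertex components of $G[D]$. For $X\subseteq V$, $X_{\mathrm{op}}(A_1,A_3,M,X)$ is the set of $v\in A$ with either $v\in A_1$ and $v,M(v)\in X$, or $v\in A_3$ and $v\in X$. $H(G,A,B,D,M)$ is the directed graph on vertex set $A$ with an arc $(u,v)$ whenever there is $w\in D$ with $\{u,w\}\in E\setminus M$ and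 $\{w,v\}\in M$. A vertex cover $X$ of $G$ is dominant (with respect to the decomposition) if $G$ has no vertex cover of size less than $|X|$ and no vertex cover of size $|X|$ contains fewer vertices of $D$ than $X$. Reachability allows paths of length zero. -}

module Defs where

open import Data.Nat using (ℕ; zero; suc; _≤_; _<ᵇ_)
open import Data.Nat.ListAction using (sum)
open import Data.Bool using (Bool; true; false; _∧_; if_then_else_)
open import Data.Fin using (Fin; toℕ)
open import Data.Fin.Subset using (Subset; _∈_; _∉_; ∣_∣; _∩_; _-_)
open import Data.List using (map; allFin)
open import Data.Product using (Σ; ∃; ∃-syntax; _×_; _,_)
open import Data.Sum using (_⊎_)
open import Relation.Nullary using (¬_)
open import Relation.Binary.PropositionalEquality using (_≡_; _≢_)
open import Function.Bundles using (_⇔_)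

record Graph (n : ℕ) : Set where
  field
    adj    : Fin n → Fin n → Bool
    sym    : ∀ u v → adj u v ≡ adj v u
    irrefl : ∀ v → adj v v ≡ false
open Graph public

-- An edge set (symmetric Boolean relation) on Fin n; a matching is given
-- by M u v ≡ true iff {u,v} ∈ M.
EdgeSet : ℕ → Set
EdgeSet n = Fin n → Fin n → Bool

record IsMatching {n : ℕ} (G : Graph n) (M : EdgeSet n) : Set where
  field
    sub    : ∀ u v → M u v ≡ true → adj G u v ≡ true
    msym   : ∀ u v → M u v ≡ M v u
    unique : ∀ u v w → M u v ≡ true → M u w ≡ true → v ≡ w

size : {n : ℕ} → EdgeSet n → ℕ
size {n} M = sum (map (λ i → sum (map (λ j →
  if M i j ∧ (toℕ i <ᵇ toℕ j) then 1 else 0) (allFin n))) (allFin n))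

IsMaximumMatching : {n : ℕ} → Graph n → EdgeSet n → Set
IsMaximumMatching G M =
  IsMatching G M × (∀ M' → IsMatching G M' → size M' ≤ size M)

IsPerfectMatchingOf : {n : ℕ} → Graph n → Subset n → EdgeSet n → Set
IsPerfectMatchingOf G S M' =
  IsMatching G M'
  × (∀ x y → M' x y ≡ true → x ∈ S × y ∈ S)
  × (∀ x → x ∈ S → ∃[ y ] M' x y ≡ true)

IsFactorCritical : {n : ℕ} → Graph n → Subset n → Set
IsFactorCritical G C = ∀ v → v ∈ C → ∃[ M' ] IsPerfectMatchingOf G (C - v) M'

data PathIn {n : ℕ} (G : Graph n) (S : Subset n) : Fin n → Fin n → Set where
  here : ∀ {v} → v ∈ S → PathIn G S v v
  step : ∀ {u w v} → u ∈ S → adj G u w ≡ true → PathIn G S w v → PathIn G S u v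

IsComponent : {n : ℕ} → Graph n → Subset n → Subset n → Set
IsComponent G S C =
  (∃[ u ] u ∈ C) × (∀ u v → u ∈ C → (v ∈ C ⇔ PathIn G S u v))

record IsRelaxedGED {n : ℕ} (G : Graph n) (A B D : Subset n) (M : EdgeSet n) : Set where
  field
    cover    : ∀ v → v ∈ A ⊎ v ∈ B ⊎ v ∈ D
    disjAB   : ∀ v → ¬ (v ∈ A × v ∈ B)
    disjAD   : ∀ v → ¬ (v ∈ A × v ∈ D)
    disjBD   : ∀ v → ¬ (v ∈ B × v ∈ D)
    maximum  : IsMaximumMatching G M
    A≡N[D]   : ∀ v → v ∈ A ⇔ (v ∉ D × ∃[ w ] (w ∈ D × adj G v w ≡ true))
    factCrit : ∀ C → IsComponent G D C → IsFactorCritical G C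
    perfB    : ∀ x → x ∈ B → ∃[ y ] (y ∈ B × M x y ≡ true)
    nearC    : ∀ C → IsComponent G D C →
               ∃[ u ] (u ∈ C × (∀ y → y ∈ C → M u y ≡ false)
                 × (∀ x → x ∈ C → x ≢ u → ∃[ y ] (y ∈ C × M x y ≡ true)))
    matchA   : ∀ v → v ∈ A → ∃[ w ] (w ∈ D × M v w ≡ true)

IsMatchedComp : {n : ℕ} → Subset n → EdgeSet n → Subset n → Set
IsMatchedComp A M C = ∃[ a ] ∃[ w ] (a ∈ A × w ∈ C × M a w ≡ true)

IsNiceDecomp : {n : ℕ} (G : Graph n) (A B D : Subset n) (M : EdgeSet n) → Set
IsNiceDecomp G A B D M =
  IsRelaxedGED G A B D M
  × (∀ C → IsComponent G D C → ∣ C ∣ ≡ 1 → IsMatchedComp A M C)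

InA1 : {n : ℕ} → Graph n → Subset n → Subset n → EdgeSet n → Fin n → Set
InA1 G A D M v = v ∈ A × ∃[ w ] (M v w ≡ true × ∃[ C ] (IsComponent G D C × w ∈ C × ∣ C ∣ ≡ 1))

InA3 : {n : ℕ} → Graph n → Subset n → Subset n → EdgeSet n → Fin n → Set
InA3 G A D M v = v ∈ A × ∃[ w ] (M v w ≡ true × ∃[ C ] (IsComponent G D C × w ∈ C × 2 ≤ ∣ C ∣))

InXop : {n : ℕ} → Graph n → Subset n → Subset n → EdgeSet n → Subset n → Fin n → Set
InXop G A D M X v =
  v ∈ A × ((InA1 G A D M v × v ∈ X × ∃[ w ] (M v w ≡ true × w ∈ X))
           ⊎ (InA3 G A D M v × v ∈ X))

HArc : {n : ℕ} → Graph n → Subset n → Subset n → EdgeSet n → Fin n → Fin n → Set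
HArc G A D M u v = u ∈ A × v ∈ A ×
  ∃[ w ] (w ∈ D × adj G u w ≡ true × M u w ≡ false × M w v ≡ true)

data ReachHminus {n : ℕ} (G : Graph n) (A D : Subset n) (M : EdgeSet n) (X : Subset n)
     : Fin n → Fin n → Set where
  here : ∀ {v} → v ∈ A → ¬ InXop G A D M X v → ReachHminus G A D M X v v
  step : ∀ {u w v} → ¬ InXop G A D M X u → HArc G A D M u w →
         ReachHminus G A D M X w v → ReachHminus G A D M X u v

ReachableFromA3 : {n : ℕ} → Graph n → Subset n → Subset n → EdgeSet n → Subset n → Fin n → Set
ReachableFromA3 G A D M X v = ∃[ u ] (InA3 G A D M u × ReachHminus G A D M X u v)

IsVertexCover : {n : ℕ} → Graph n → Subset n → Set
IsVertexCover G X = ∀ u v → adj G u v ≡ true → u ∈ X ⊎ v ∈ X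

IsDominantVC : {n : ℕ} → Graph n → Subset n → Subset n → Set
IsDominantVC G D X =
  IsVertexCover G X
  × (∀ Y → IsVertexCover G Y → ∣ X ∣ ≤ ∣ Y ∣)
  × (∀ Y → IsVertexCover G Y → ∣ Y ∣ ≡ ∣ X ∣ → ∣ X ∩ D ∣ ≤ ∣ Y ∩ D ∣)

-- Suppose v ∉ X, and let T be the set of vertices outside X from which v is
-- reachable in H − X_op. Each t ∈ T is matched to a vertex M(t) ∈ X ∩ D, and M(t)
-- is a single-vertex component of G[D], as t is not reachable from A₃. Exchanging
-- every t ∈ T for M(t) turns X into a set Y of the same size; Y is again a vertex
-- cover because T is closed under predecessors in H, and Y ∩ D ⊊ X ∩ D since M(v)
-- leaves. This contradicts the dominance of X.
module Submission where

open import Defs hiding (sym)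
open import Data.Nat using (ℕ; zero; suc; _≤_; _<_; _+_)
open import Data.Nat.Properties using (≤-trans; <-≤-trans; <⇒≱; +-suc; +-identityʳ; +-monoˡ-≤; ≤-reflexive; m≤n+m; +-0-commutativeMonoid)
open import Data.Fin using (Fin; zero; suc)
open import Data.Fin.Properties using (any?)
open import Data.Fin.Subset using (Subset; _∈_; _∉_; _⊂_; ∣_∣; _∪_; _∩_; ⁅_⁆)
open import Data.Fin.Subset.Properties using (_∈?_; p⊂q⇒∣p∣<∣q∣; ∣p∣≤n; x∈⁅x⁆; x∈⁅y⁆⇒x≡y; ∣⁅x⁆∣≡1; p⊆p∪q; x∈p∪q⁺; x∈p∪q⁻; x∈p∩q⁺; x∈p∩q⁻)
open import Data.Fin.Permutation using (permutation)
open import Data.Vec using (lookup; tabulate)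
open import Data.Vec.Properties using ([]=⇒lookup; lookup⇒[]=; lookup∘tabulate; tabulate∘lookup)
open import Data.Bool using (Bool; true; false; if_then_else_)
import Data.Bool as Bool
open import Data.Product using (∃-syntax; _×_; _,_; proj₁; proj₂)
open import Data.Sum using (_⊎_; inj₁; inj₂)
import Data.Sum as Sum
open import Data.Empty using (⊥; ⊥-elim)
open import Function using (_∘_)
open import Function.Bundles using (_⇔_; Equivalence; mk⇔)
open import Level using (Level; _⊔_)
open import Relation.Nullary using (¬_; Dec; yes; no; ¬?; _×-dec_; _⊎-dec_; contradiction)
open import Relation.Binary.PropositionalEquality using (_≡_; _≢_; refl; sym; trans; cong; subst; module ≡-Reasoning)
open import Algebra.Properties.CommutativeMonoid.Sum +-0-commutativeMonoid using (sum; sum-permute)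

private
  variable
    m n : ℕ
    ℓ ℓ′ : Level

preimage : (Fin m → Fin n) → Subset n → Subset m
preimage f p = tabulate (lookup p ∘ f)

∈-preimage⁺ : ∀ {f : Fin m → Fin n} {p x} → f x ∈ p → x ∈ preimage f p
∈-preimage⁺ {f = f} {p} {x} fx∈p =
  lookup⇒[]= x _ (trans (lookup∘tabulate (lookup p ∘ f) x) ([]=⇒lookup fx∈p))

∈-preimage⁻ : ∀ {f : Fin m → Fin n} {p x} → x ∈ preimage f p → f x ∈ p
∈-preimage⁻ {f = f} {p} {x} x∈ =
  lookup⇒[]= (f x) p (trans (sym (lookup∘tabulate (lookup p ∘ f) x)) ([]=⇒lookup x∈))

∣tabulate∣ : (h : Fin n → Bool) → ∣ tabulate h ∣ ≡ sum (λ i → if h i then 1 else 0)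
∣tabulate∣ {zero}  h = refl
∣tabulate∣ {suc n} h with h zero
... | true  = cong suc (∣tabulate∣ (h ∘ suc))
... | false = ∣tabulate∣ (h ∘ suc)

∣preimage∣-involutive : ∀ {f : Fin n → Fin n} → (∀ x → f (f x) ≡ x) →
                        (p : Subset n) → ∣ preimage f p ∣ ≡ ∣ p ∣
∣preimage∣-involutive {n} {f} f∘f≡id p = begin
  ∣ tabulate (lookup p ∘ f) ∣           ≡⟨ ∣tabulate∣ (lookup p ∘ f) ⟩
  sum (indicator ∘ f)                   ≡⟨ sum-permute indicator (permutation f f f∘f≡id f∘f≡id) ⟨
  sum indicator                         ≡⟨ ∣tabulate∣ (lookup p) ⟨
  ∣ tabulate (lookup p) ∣               ≡⟨ cong ∣_∣ (tabulate∘lookup p) ⟩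
  ∣ p ∣                                 ∎
  where
  open ≡-Reasoning
  indicator : Fin n → ℕ
  indicator i = if lookup p i then 1 else 0

2≤∣p∣ : ∀ {p : Subset n} {x y} → x ∈ p → y ∈ p → x ≢ y → 2 ≤ ∣ p ∣
2≤∣p∣ {p = p} {x} {y} x∈p y∈p x≢y =
  subst (_< ∣ p ∣) (∣⁅x⁆∣≡1 x)
        (p⊂q⇒∣p∣<∣q∣ (⁅x⁆⊆p , y , y∈p , λ y∈⁅x⁆ → x≢y (sym (x∈⁅y⁆⇒x≡y x y∈⁅x⁆))))
  where
  ⁅x⁆⊆p : ∀ {z} → z ∈ ⁅ x ⁆ → z ∈ p
  ⁅x⁆⊆p z∈⁅x⁆ = subst (_∈ p) (sym (x∈⁅y⁆⇒x≡y x z∈⁅x⁆)) x∈p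

record PredecessorClosure (R : Fin n → Fin n → Set ℓ) (Q : Fin n → Set ℓ′) (s : Fin n) : Set (ℓ ⊔ ℓ′) where
  field
    carrier   : Subset n
    seed      : s ∈ carrier
    invariant : ∀ {x} → x ∈ carrier → Q x
    closed    : ∀ {x y} → R x y → y ∈ carrier → x ∈ carrier

-- Add one missing predecessor at a time; the size of the set bounds the number of rounds.
predecessor-closure :
  (R : Fin n → Fin n → Set ℓ) → (∀ x y → Dec (R x y)) →
  (Q : Fin n → Set ℓ′) → (∀ {x y} → R x y → Q y → Q x) →
  ∀ {s} → Q s → PredecessorClosure R Q s
predecessor-closure {n} R R? Q Q-pred {s} Qs =
  grow n ⁅ s ⁆ (m≤n+m n ∣ ⁅ s ⁆ ∣) (x∈⁅x⁆ s) (λ x∈⁅s⁆ → subst Q (sym (x∈⁅y⁆⇒x≡y s x∈⁅s⁆)) Qs)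
  where
  grow : (k : ℕ) (C : Subset n) → n ≤ ∣ C ∣ + k → s ∈ C → (∀ {x} → x ∈ C → Q x) →
         PredecessorClosure R Q s
  grow k C bound s∈C QC with any? (λ x → ¬? (x ∈? C) ×-dec any? (λ y → (y ∈? C) ×-dec R? x y))
  ... | no noNewPredecessor = record { carrier = C ; seed = s∈C ; invariant = QC ; closed = closed }
    where
    closed : ∀ {x y} → R x y → y ∈ C → x ∈ C
    closed {x} {y} Rxy y∈C with x ∈? C
    ... | yes x∈C = x∈C
    ... | no  x∉C = contradiction (x , x∉C , y , y∈C , Rxy) noNewPredecessor
  ... | yes (x , x∉C , y , y∈C , Rxy) = grow′ k bound
    where
    C′ = C ∪ ⁅ x ⁆

    ∣C∣<∣C′∣ : ∣ C ∣ < ∣ C′ ∣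
    ∣C∣<∣C′∣ = p⊂q⇒∣p∣<∣q∣ (p⊆p∪q ⁅ x ⁆ , x , x∈p∪q⁺ (inj₂ (x∈⁅x⁆ x)) , x∉C)

    QC′ : ∀ {z} → z ∈ C′ → Q z
    QC′ z∈C′ with x∈p∪q⁻ C ⁅ x ⁆ z∈C′
    ... | inj₁ z∈C    = QC z∈C
    ... | inj₂ z∈⁅x⁆ = subst Q (sym (x∈⁅y⁆⇒x≡y x z∈⁅x⁆)) (Q-pred Rxy (QC y∈C))

    grow′ : (k : ℕ) → n ≤ ∣ C ∣ + k → PredecessorClosure R Q s
    grow′ zero    bound′ = contradiction (≤-trans bound′ (≤-reflexive (+-identityʳ ∣ C ∣)))
                                         (<⇒≱ (<-≤-trans ∣C∣<∣C′∣ (∣p∣≤n C′)))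
    grow′ (suc k) bound′ =
      grow k C′ (≤-trans bound′ (≤-trans (≤-reflexive (+-suc ∣ C ∣ k)) (+-monoˡ-≤ k ∣C∣<∣C′∣)))
                (p⊆p∪q ⁅ x ⁆ s∈C) QC′

module Swap (P : Fin n → Fin n → Set ℓ) (P? : ∀ x y → Dec (P x y))
            (P-sym : ∀ {x y} → P x y → P y x)
            (P-functional : ∀ {x y z} → P x y → P x z → y ≡ z) where

  swap : Fin n → Fin n
  swap x with any? (P? x)
  ... | yes (y , _) = y
  ... | no  _       = x

  swap-cases : ∀ x → P x (swap x) ⊎ swap x ≡ x
  swap-cases x with any? (P? x)
  ... | yes (_ , Pxy) = inj₁ Pxy
  ... | no  _         = inj₂ refl

  swap-of-partner : ∀ {x y} → P x y → swap x ≡ y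
  swap-of-partner {x} Pxy with any? (P? x)
  ... | yes (_ , Pxz) = P-functional Pxz Pxy
  ... | no  none      = contradiction (_ , Pxy) none

  swap-involutive : ∀ x → swap (swap x) ≡ x
  swap-involutive x with swap-cases x
  ... | inj₁ P-x-swapx = swap-of-partner (P-sym P-x-swapx)
  ... | inj₂ swapx≡x   = trans (cong swap swapx≡x) swapx≡x

module Path {G : Graph n} {S : Subset n} where

  source∈ : ∀ {a b} → PathIn G S a b → a ∈ S
  source∈ (here a∈S)     = a∈S
  source∈ (step a∈S _ _) = a∈S

  snoc : ∀ {a b c} → PathIn G S a b → adj G b c ≡ true → c ∈ S → PathIn G S a c
  snoc (here b∈S)         e c∈S = step b∈S e (here c∈S)
  snoc (step a∈S e′ path) e c∈S = step a∈S e′ (snoc path e c∈S)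

  _++_ : ∀ {a b c} → PathIn G S a b → PathIn G S b c → PathIn G S a c
  here _           ++ path′ = path′
  step a∈S e path ++ path′ = step a∈S e (path ++ path′)

  reverse : ∀ {a b} → PathIn G S a b → PathIn G S b a
  reverse (here a∈S)                = here a∈S
  reverse (step {a} {c} a∈S e path) = snoc (reverse path) (trans (Graph.sym G c a) e) a∈S

component-of : (G : Graph n) {S : Subset n} {w : Fin n} → w ∈ S → ∃[ C ] (IsComponent G S C × w ∈ C)
component-of {n} G {S} {w} w∈S = carrier , ((w , seed) , path⇔) , seed
  where
  Neighbour : Fin n → Fin n → Set
  Neighbour a b = a ∈ S × adj G b a ≡ true

  open PredecessorClosure (predecessor-closure Neighbour (λ a b → (a ∈? S) ×-dec (adj G b a Bool.≟ true))
                             (PathIn G S w) (λ (a∈S , e) path → Path.snoc path e a∈S) (here w∈S))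

  along : ∀ {u v} → PathIn G S u v → u ∈ carrier → v ∈ carrier
  along (here _)        u∈C = u∈C
  along (step _ e path) u∈C = along path (closed (Path.source∈ path , e) u∈C)

  path⇔ : ∀ u v → u ∈ carrier → (v ∈ carrier ⇔ PathIn G S u v)
  path⇔ u v u∈C = mk⇔ (λ v∈C → Path.reverse (invariant u∈C) Path.++ invariant v∈C) (λ path → along path u∈C)

nontrivial-component : (G : Graph n) {S : Subset n} {w w′ : Fin n} → w ∈ S → w′ ∈ S → adj G w w′ ≡ true →
                       ∃[ C ] (IsComponent G S C × w ∈ C × 2 ≤ ∣ C ∣)
nontrivial-component G {S} {w} {w′} w∈S w′∈S e with component-of G w∈S
... | C , isComp@(_ , path⇔) , w∈C = C , isComp , w∈C , 2≤∣p∣ w∈C w′∈C w≢w′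
  where
  w′∈C : w′ ∈ C
  w′∈C = Equivalence.from (path⇔ w w′ w∈C) (step w∈S e (here w′∈S))
  w≢w′ : w ≢ w′
  w≢w′ refl = contradiction (trans (sym e) (irrefl G w)) λ ()

module _ (G : Graph n) (A D : Subset n) (M : EdgeSet n) where

  HArc? : ∀ u v → Dec (HArc G A D M u v)
  HArc? u v = (u ∈? A) ×-dec (v ∈? A) ×-dec
              any? (λ w → (w ∈? D) ×-dec (adj G u w Bool.≟ true) ×-dec (M u w Bool.≟ false) ×-dec (M w v Bool.≟ true))

  ∉⇒¬InXop : ∀ {X x} → x ∉ X → ¬ InXop G A D M X x
  ∉⇒¬InXop x∉X (_ , inj₁ (_ , x∈X , _)) = x∉X x∈X
  ∉⇒¬InXop x∉X (_ , inj₂ (_ , x∈X))     = x∉X x∈X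

  ReachHminus-source∈A : ∀ {X x y} → ReachHminus G A D M X x y → x ∈ A
  ReachHminus-source∈A (here x∈A _)          = x∈A
  ReachHminus-source∈A (step _ (x∈A , _) _) = x∈A

module Exchange {G : Graph n} {A B D : Subset n} {M : EdgeSet n} {X : Subset n}
                (ged : IsRelaxedGED G A B D M) (dominant : IsDominantVC G D X)
                {v : Fin n} (v∈A : v ∈ A) (v∉X : v ∉ X) (unreachable : ¬ ReachableFromA3 G A D M X v) where

  open IsRelaxedGED ged
  open IsMatching (proj₁ maximum)

  M-sym : ∀ {a b} → M a b ≡ true → M b a ≡ true
  M-sym {a} {b} Mab = trans (msym b a) Mab

  adj-sym : ∀ {a b} → adj G a b ≡ true → adj G b a ≡ true
  adj-sym {a} {b} e = trans (Graph.sym G b a) e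

  X-cover : IsVertexCover G X
  X-cover = proj₁ dominant

  mate∈D : ∀ {a x} → a ∈ A → M a x ≡ true → x ∈ D
  mate∈D {a} a∈A Max with matchA a a∈A
  ... | w , w∈D , Maw = subst (_∈ D) (unique a w _ Maw Max) w∈D

  Backward : Fin n → Fin n → Set
  Backward x y = x ∉ X × HArc G A D M x y

  ReachesV : Fin n → Set
  ReachesV x = x ∉ X × ReachHminus G A D M X x v

  open PredecessorClosure
    (predecessor-closure Backward (λ x y → ¬? (x ∈? X) ×-dec HArc? G A D M x y) ReachesV
       (λ (x∉X , arc) (_ , reach) → x∉X , step (∉⇒¬InXop G A D M x∉X) arc reach)
       (v∉X , here v∈A (∉⇒¬InXop G A D M v∉X)))
    renaming (carrier to T; seed to v∈T; closed to T-closed)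

  T⊆A : ∀ {t} → t ∈ T → t ∈ A
  T⊆A t∈T = ReachHminus-source∈A G A D M (proj₂ (invariant t∈T))

  T∩X≡∅ : ∀ {t} → t ∈ T → t ∉ X
  T∩X≡∅ t∈T = proj₁ (invariant t∈T)

  T-mate∈X : ∀ {t x} → t ∈ T → M t x ≡ true → x ∈ X
  T-mate∈X {t} {x} t∈T Mtx with X-cover t x (sub t x Mtx)
  ... | inj₁ t∈X = contradiction t∈X (T∩X≡∅ t∈T)
  ... | inj₂ x∈X = x∈X

  -- Otherwise t would lie in A₃ and reach v.
  T-mate-isolated : ∀ {t x x′} → t ∈ T → M t x ≡ true → adj G x x′ ≡ true → x′ ∉ D
  T-mate-isolated {t} {x} t∈T Mtx e x′∈D with nontrivial-component G (mate∈D (T⊆A t∈T) Mtx) x′∈D e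
  ... | C , isComp , x∈C , 2≤∣C∣ =
    unreachable (t , (T⊆A t∈T , x , Mtx , C , isComp , x∈C , 2≤∣C∣) , proj₂ (invariant t∈T))

  Partner : Fin n → Fin n → Set
  Partner x y = M x y ≡ true × (x ∈ T ⊎ y ∈ T)

  open Swap Partner (λ x y → (M x y Bool.≟ true) ×-dec ((x ∈? T) ⊎-dec (y ∈? T)))
            (λ (Mxy , x∈T⊎y∈T) → M-sym Mxy , Sum.swap x∈T⊎y∈T)
            (λ {x} {y} {z} (Mxy , _) (Mxz , _) → unique x y z Mxy Mxz)

  Y : Subset n
  Y = preimage swap X

  swap-of-T : ∀ {t x} → t ∈ T → M t x ≡ true → swap t ≡ x
  swap-of-T t∈T Mtx = swap-of-partner (Mtx , inj₁ t∈T)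

  swap-of-T-mate : ∀ {t x} → t ∈ T → M t x ≡ true → swap x ≡ t
  swap-of-T-mate t∈T Mtx = swap-of-partner (M-sym Mtx , inj₂ t∈T)

  T⊆Y : ∀ {t} → t ∈ T → t ∈ Y
  T⊆Y {t} t∈T with matchA t (T⊆A t∈T)
  ... | x , _ , Mtx = ∈-preimage⁺ (subst (_∈ X) (sym (swap-of-T t∈T Mtx)) (T-mate∈X t∈T Mtx))

  T-mate∉Y : ∀ {t x} → t ∈ T → M t x ≡ true → x ∉ Y
  T-mate∉Y t∈T Mtx x∈Y = T∩X≡∅ t∈T (subst (_∈ X) (swap-of-T-mate t∈T Mtx) (∈-preimage⁻ x∈Y))

  data Role (x : Fin n) : Set where
    in-T    : x ∈ T → Role x
    T-mate  : ∀ {t} → t ∈ T → M t x ≡ true → Role x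
    fixed   : swap x ≡ x → Role x

  role : ∀ x → Role x
  role x with swap-cases x
  ... | inj₁ (_    , inj₁ x∈T)  = in-T x∈T
  ... | inj₁ (Mxs , inj₂ sx∈T) = T-mate sx∈T (M-sym Mxs)
  ... | inj₂ sx≡x               = fixed sx≡x

  fixed-∈Y⁺ : ∀ {x} → swap x ≡ x → x ∈ X → x ∈ Y
  fixed-∈Y⁺ sx≡x x∈X = ∈-preimage⁺ (subst (_∈ X) (sym sx≡x) x∈X)

  fixed-∈Y⁻ : ∀ {x} → swap x ≡ x → x ∈ Y → x ∈ X
  fixed-∈Y⁻ sx≡x x∈Y = subst (_∈ X) sx≡x (∈-preimage⁻ x∈Y)

  X─D⊆Y : ∀ {x} → x ∈ X → x ∉ D → x ∈ Y
  X─D⊆Y {x} x∈X x∉D with role x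
  ... | in-T x∈T       = T⊆Y x∈T
  ... | T-mate t∈T Mtx = contradiction (mate∈D (T⊆A t∈T) Mtx) x∉D
  ... | fixed sx≡x     = fixed-∈Y⁺ sx≡x x∈X

  Y─X⊆T : ∀ {x} → x ∈ Y → x ∉ X → x ∈ T
  Y─X⊆T {x} x∈Y x∉X with role x
  ... | in-T x∈T       = x∈T
  ... | T-mate t∈T Mtx = contradiction x∈Y (T-mate∉Y t∈T Mtx)
  ... | fixed sx≡x     = contradiction (fixed-∈Y⁻ sx≡x x∈Y) x∉X

  -- The mate a of t ∈ T has no neighbour in D, so its neighbours lie in A, where
  -- closedness of T under arcs of H puts them in T ∪ X.
  T-mate-neighbour∈Y : ∀ {t a b} → t ∈ T → M t a ≡ true → adj G a b ≡ true → b ∈ Y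
  T-mate-neighbour∈Y {t} {a} {b} t∈T Mta e with b ∈? X | M b a in Mba
  ... | yes b∈X | _     = X─D⊆Y b∈X (T-mate-isolated t∈T Mta e)
  ... | no  _   | true  = T⊆Y (subst (_∈ T) (unique a t b (M-sym Mta) (M-sym Mba)) t∈T)
  ... | no  b∉X | false = T⊆Y (T-closed (b∉X , b∈A , T⊆A t∈T , a , a∈D , adj-sym e , Mba , M-sym Mta) t∈T)
    where
    a∈D = mate∈D (T⊆A t∈T) Mta
    b∈A = Equivalence.from (A≡N[D] b) (T-mate-isolated t∈T Mta e , a , a∈D , adj-sym e)

  edge-covered-or-fixed : ∀ {a b} → adj G a b ≡ true → a ∈ Y ⊎ b ∈ Y ⊎ swap a ≡ a
  edge-covered-or-fixed {a} e with role a
  ... | in-T a∈T       = inj₁ (T⊆Y a∈T)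
  ... | T-mate t∈T Mta = inj₂ (inj₁ (T-mate-neighbour∈Y t∈T Mta e))
  ... | fixed sa≡a     = inj₂ (inj₂ sa≡a)

  Y-cover : IsVertexCover G Y
  Y-cover a b e with edge-covered-or-fixed e | edge-covered-or-fixed (adj-sym e)
  ... | inj₁ a∈Y          | _                 = inj₁ a∈Y
  ... | inj₂ (inj₁ b∈Y)   | _                 = inj₂ b∈Y
  ... | _                 | inj₁ b∈Y          = inj₂ b∈Y
  ... | _                 | inj₂ (inj₁ a∈Y)   = inj₁ a∈Y
  ... | inj₂ (inj₂ sa≡a)  | inj₂ (inj₂ sb≡b) with X-cover a b e
  ...   | inj₁ a∈X = inj₁ (fixed-∈Y⁺ sa≡a a∈X)
  ...   | inj₂ b∈X = inj₂ (fixed-∈Y⁺ sb≡b b∈X)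

  Y∩D⊂X∩D : Y ∩ D ⊂ X ∩ D
  Y∩D⊂X∩D with matchA v v∈A
  ... | w , w∈D , Mvw = Y∩D⊆X∩D , w , x∈p∩q⁺ (T-mate∈X v∈T Mvw , w∈D) ,
                        λ w∈Y∩D → T-mate∉Y v∈T Mvw (proj₁ (x∈p∩q⁻ Y D w∈Y∩D))
    where
    Y∩D⊆X∩D : ∀ {x} → x ∈ Y ∩ D → x ∈ X ∩ D
    Y∩D⊆X∩D {x} x∈Y∩D with x∈p∩q⁻ Y D x∈Y∩D
    ... | x∈Y , x∈D with x ∈? X
    ...   | yes x∈X = x∈p∩q⁺ (x∈X , x∈D)
    ...   | no  x∉X = contradiction (T⊆A (Y─X⊆T x∈Y x∉X) , x∈D) (disjAD x)

  impossible : ⊥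
  impossible = <⇒≱ (p⊂q⇒∣p∣<∣q∣ Y∩D⊂X∩D)
                   (proj₂ (proj₂ dominant) Y Y-cover (∣preimage∣-involutive swap-involutive X))

lemma21 : {n : ℕ} (G : Graph n) (A B D : Subset n) (M : EdgeSet n) (X : Subset n)
          → IsNiceDecomp G A B D M
          → IsDominantVC G D X
          → (v : Fin n) → v ∈ A
          → ¬ ReachableFromA3 G A D M X v
          → v ∈ X
lemma21 G A B D M X nice dominant v v∈A unreachable with v ∈? X
... | yes v∈X = v∈X
... | no  v∉X = ⊥-elim (Exchange.impossible (proj₁ nice) dominant v∈A v∉X unreachable)
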